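{- Let $B$ be a bidirected graph such that for any two vertices $v$ and $w$ of $B$ there are a $(v,+)$--$w$ path and a $(v,-)$--$w$ path in $B$. Then $B$ is strongly connected.
   Context: A bidirected graph $B=(G,\sigma)$ consists of an undirected graph $G$ without loops (no two distinct edges have the same endvertices and the same signs at them) together with a signing $\sigma$ assigning to every pair $(u,e)$, $u$ an endvertex of the edge $e$, a sign $\sigma(u,e)\in\{+,-\}$. A signed vertex is a pair $(v,\alpha)$, $v\in V(B)$, $\alpha\in\{+,-\}$. A walk is a sequence $v_0\vec e_1v_1\dots\vec e_\ell v_\ell$ where $\vec e_j$ is the edge $e_j$ oriented from $v_{j-1}$ to $v_j$ and $\sigma(v_i,e_i)\neq\sigma(v_i,e_{i+1})$ for $1\le i\le\ell-1$; a path is a walk with all vertices (hence all edges) distinct. A nontrivial ($\ell\ge1$) walk starts in the signed vertex $(v_0,\sigma(v_0,e_1))$ and ends in $(v_\ell,\sigma(v_\ell,e_\ell))$. A $(v,\alpha)$--$w$ path is a path starting in $(v,\alpha)$ with endvertex $w$; a $(v,\alpha)$--$(w,\beta)$ path starts in $(v,\alpha)$ and ends in $(w,\beta)$. $B$ is strongly connected if for any two vertices $v,w$ of $B$ there are signs $\alpha,\beta$ such that $B$ contains both a $(v,\alpha)$--$(w,\beta)$ path and a $(v,-\alpha)$--$(w,-\beta)$ path. -}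

module Defs where

open import Data.Product using (Σ; ∃; ∃-syntax; _×_; _,_)
open import Data.List using (List; []; _∷_; map)
open import Data.List.Relation.Unary.Unique.Propositional using (Unique)
open import Data.Empty using (⊥)
open import Data.Unit using (⊤)
open import Relation.Binary.PropositionalEquality using (_≡_; _≢_)

data Sign : Set where
  + - : Sign

neg : Sign → Sign
neg + = -
neg - = +

-- The labelling of the two ends of an edge is arbitrary.
record Bidirected : Set₁ where
  field
    V    : Set
    E    : Set
    end₁ : E → V
    end₂ : E → V
    sgn₁ : E → Sign
    sgn₂ : E → Sign
    loopless : ∀ e → end₁ e ≢ end₂ e
    simple₁ : ∀ e f → end₁ e ≡ end₁ f → end₂ e ≡ end₂ f →
              sgn₁ e ≡ sgn₁ f → sgn₂ e ≡ sgn₂ f → e ≡ f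
    simple₂ : ∀ e f → end₁ e ≡ end₂ f → end₂ e ≡ end₁ f →
              sgn₁ e ≡ sgn₂ f → sgn₂ e ≡ sgn₁ f → e ≡ f

module _ (B : Bidirected) where
  open Bidirected B

  data Dir : Set where
    fwd bwd : Dir

  Dart : Set
  Dart = E × Dir

  tl : Dart → V
  tl (e , fwd) = end₁ e
  tl (e , bwd) = end₂ e

  hd : Dart → V
  hd (e , fwd) = end₂ e
  hd (e , bwd) = end₁ e

  stl : Dart → Sign
  stl (e , fwd) = sgn₁ e
  stl (e , bwd) = sgn₂ e

  shd : Dart → Sign
  shd (e , fwd) = sgn₂ e
  shd (e , bwd) = sgn₁ e

  Consistent : Dart → List Dart → Set
  Consistent d []         = ⊤
  Consistent d (d' ∷ ds)  = (hd d ≡ tl d') × (shd d ≢ stl d') × Consistent d' ds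

  lastDart : Dart → List Dart → Dart
  lastDart d []        = d
  lastDart d (d' ∷ ds) = lastDart d' ds

  vertices : Dart → List Dart → List V
  vertices d ds = tl d ∷ hd d ∷ map hd ds

  record Path (v : V) (α : Sign) (w : V) (β : Sign) : Set where
    field
      first    : Dart
      rest     : List Dart
      walk     : Consistent first rest
      distinct : Unique (vertices first rest)
      startV   : tl first ≡ v
      startS   : stl first ≡ α
      endV     : hd (lastDart first rest) ≡ w
      endS     : shd (lastDart first rest) ≡ β

  PathTo : V → Sign → V → Set
  PathTo v α w = ∃[ β ] Path v α w β

  StronglyConnected : Set
  StronglyConnected = ∀ v w → v ≢ w →
    ∃[ α ] ∃[ β ] (Path v α w β × Path v (neg α) w (neg β))

-- Reversing a (v , α)–(w , β) path yields a (w , β)–(v , α) path.  If the given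
-- (v , +)–w and (v , -)–w paths end at w with opposite signs they already form
-- the required pair.  Otherwise both end with the same sign β; take a
-- (w , neg β)–v path, ending at v with sign γ say.  Its reversal is a
-- (v , γ)–(w , neg β) path, and together with the given (v , neg γ)–(w , β)
-- path it forms the pair.
module Submission where

open import Defs
open import Function using (_∘_)
open import Relation.Binary.PropositionalEquality
  using (_≡_; _≢_; refl; sym; trans; cong; cong₂; subst; setoid; module ≡-Reasoning)
open import Data.Product using (_×_; _,_; ∃-syntax)
open import Data.Unit using (tt)
open import Data.List using (List; []; _∷_; [_]; map; reverse; _∷ʳ_)
open import Data.List.Properties using (map-++; unfold-reverse)
open import Data.List.Relation.Unary.Unique.Propositional using (Unique)
open import Data.List.Relation.Binary.Permutation.Propositional using (↭⇒↭ₛ; ↭-sym)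
open import Data.List.Relation.Binary.Permutation.Propositional.Properties using (↭-reverse)
import Data.List.Relation.Binary.Permutation.Setoid.Properties as PermutationProperties

Unique-reverse : ∀ {A : Set} (xs : List A) → Unique xs → Unique (reverse xs)
Unique-reverse {A} xs =
  PermutationProperties.Unique-resp-↭ (setoid A) (↭⇒↭ₛ (↭-sym (↭-reverse xs)))

module _ (B : Bidirected) where

  reverseDart : Dart B → Dart B
  reverseDart (e , fwd) = e , bwd
  reverseDart (e , bwd) = e , fwd

  tl-reverseDart : ∀ d → tl B (reverseDart d) ≡ hd B d
  tl-reverseDart (e , fwd) = refl
  tl-reverseDart (e , bwd) = refl

  hd-reverseDart : ∀ d → hd B (reverseDart d) ≡ tl B d
  hd-reverseDart (e , fwd) = refl
  hd-reverseDart (e , bwd) = refl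

  stl-reverseDart : ∀ d → stl B (reverseDart d) ≡ shd B d
  stl-reverseDart (e , fwd) = refl
  stl-reverseDart (e , bwd) = refl

  shd-reverseDart : ∀ d → shd B (reverseDart d) ≡ stl B d
  shd-reverseDart (e , fwd) = refl
  shd-reverseDart (e , bwd) = refl

  lastDart-∷ʳ : ∀ d ds x → lastDart B d (ds ∷ʳ x) ≡ x
  lastDart-∷ʳ d []        x = refl
  lastDart-∷ʳ d (d' ∷ ds) x = lastDart-∷ʳ d' ds x

  Consistent-∷ʳ : ∀ d ds x → Consistent B d ds →
    hd B (lastDart B d ds) ≡ tl B x → shd B (lastDart B d ds) ≢ stl B x →
    Consistent B d (ds ∷ʳ x)
  Consistent-∷ʳ d []        x _                  meet signs = meet , signs , tt
  Consistent-∷ʳ d (d' ∷ ds) x (meet′ , signs′ , c) meet signs =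
    meet′ , signs′ , Consistent-∷ʳ d' ds x c meet signs

  vertices-∷ʳ : ∀ d ds x → vertices B d (ds ∷ʳ x) ≡ vertices B d ds ∷ʳ hd B x
  vertices-∷ʳ d ds x = cong (λ vs → tl B d ∷ hd B d ∷ vs) (map-++ (hd B) ds [ x ])

  -- The walk d ∷ ds traversed backwards is reverseFirst d ds ∷ reverseRest d ds.
  reverseFirst : Dart B → List (Dart B) → Dart B
  reverseFirst d []        = reverseDart d
  reverseFirst d (d' ∷ ds) = reverseFirst d' ds

  reverseRest : Dart B → List (Dart B) → List (Dart B)
  reverseRest d []        = []
  reverseRest d (d' ∷ ds) = reverseRest d' ds ∷ʳ reverseDart d

  reverseFirst≡reverseDart-last : ∀ d ds →
    reverseFirst d ds ≡ reverseDart (lastDart B d ds)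
  reverseFirst≡reverseDart-last d []        = refl
  reverseFirst≡reverseDart-last d (d' ∷ ds) = reverseFirst≡reverseDart-last d' ds

  lastDart-reverse : ∀ d ds →
    lastDart B (reverseFirst d ds) (reverseRest d ds) ≡ reverseDart d
  lastDart-reverse d []        = refl
  lastDart-reverse d (d' ∷ ds) =
    lastDart-∷ʳ (reverseFirst d' ds) (reverseRest d' ds) (reverseDart d)

  Consistent-reverse : ∀ d ds → Consistent B d ds →
    Consistent B (reverseFirst d ds) (reverseRest d ds)
  Consistent-reverse d []        _                  = tt
  Consistent-reverse d (d' ∷ ds) (meet , signs , c) =
    Consistent-∷ʳ (reverseFirst d' ds) (reverseRest d' ds) (reverseDart d)
      (Consistent-reverse d' ds c) meet′ (signs ∘ signs′)
    where
      open ≡-Reasoning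
      lastR = lastDart B (reverseFirst d' ds) (reverseRest d' ds)

      meet′ : hd B lastR ≡ tl B (reverseDart d)
      meet′ = begin
        hd B lastR                ≡⟨ cong (hd B) (lastDart-reverse d' ds) ⟩
        hd B (reverseDart d')     ≡⟨ hd-reverseDart d' ⟩
        tl B d'                   ≡⟨ sym meet ⟩
        hd B d                    ≡⟨ sym (tl-reverseDart d) ⟩
        tl B (reverseDart d)      ∎

      signs′ : shd B lastR ≡ stl B (reverseDart d) → shd B d ≡ stl B d'
      signs′ same = begin
        shd B d                   ≡⟨ sym (stl-reverseDart d) ⟩
        stl B (reverseDart d)     ≡⟨ sym same ⟩
        shd B lastR               ≡⟨ cong (shd B) (lastDart-reverse d' ds) ⟩
        shd B (reverseDart d')    ≡⟨ shd-reverseDart d' ⟩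
        stl B d'                  ∎

  vertices-reverse : ∀ d ds → Consistent B d ds →
    vertices B (reverseFirst d ds) (reverseRest d ds) ≡ reverse (vertices B d ds)
  vertices-reverse d [] _ =
    cong₂ (λ u u′ → u ∷ u′ ∷ []) (tl-reverseDart d) (hd-reverseDart d)
  vertices-reverse d (d' ∷ ds) (meet , _ , c) = begin
    vertices B (reverseFirst d' ds) (reverseRest d' ds ∷ʳ reverseDart d)
      ≡⟨ vertices-∷ʳ (reverseFirst d' ds) (reverseRest d' ds) (reverseDart d) ⟩
    vertices B (reverseFirst d' ds) (reverseRest d' ds) ∷ʳ hd B (reverseDart d)
      ≡⟨ cong₂ _∷ʳ_ (vertices-reverse d' ds c) (hd-reverseDart d) ⟩
    reverse (tl B d' ∷ hd B d' ∷ map (hd B) ds) ∷ʳ tl B d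
      ≡⟨ cong (λ u → reverse (u ∷ hd B d' ∷ map (hd B) ds) ∷ʳ tl B d) (sym meet) ⟩
    reverse (hd B d ∷ hd B d' ∷ map (hd B) ds) ∷ʳ tl B d
      ≡⟨ sym (unfold-reverse (tl B d) (hd B d ∷ hd B d' ∷ map (hd B) ds)) ⟩
    reverse (tl B d ∷ hd B d ∷ hd B d' ∷ map (hd B) ds)
      ∎
    where open ≡-Reasoning

  reversePath : ∀ {v α w β} → Path B v α w β → Path B w β v α
  reversePath p = record
    { first    = reverseFirst d ds
    ; rest     = reverseRest d ds
    ; walk     = Consistent-reverse d ds walk
    ; distinct = subst Unique (sym (vertices-reverse d ds walk))
                   (Unique-reverse (vertices B d ds) distinct)
    ; startV   = trans (cong (tl B) (reverseFirst≡reverseDart-last d ds))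
                   (trans (tl-reverseDart (lastDart B d ds)) endV)
    ; startS   = trans (cong (stl B) (reverseFirst≡reverseDart-last d ds))
                   (trans (stl-reverseDart (lastDart B d ds)) endS)
    ; endV     = trans (cong (hd B) (lastDart-reverse d ds))
                   (trans (hd-reverseDart d) startV)
    ; endS     = trans (cong (shd B) (lastDart-reverse d ds))
                   (trans (shd-reverseDart d) startS)
    }
    where
      open Path p renaming (first to d; rest to ds)

  OppositePaths : Bidirected.V B → Bidirected.V B → Set
  OppositePaths v w = ∃[ α ] ∃[ β ] (Path B v α w β × Path B v (neg α) w (neg β))

  OppositePaths-sameEndSign : ∀ {v w β} → (∀ α → Path B v α w β) →
    PathTo B w (neg β) v → OppositePaths v w
  OppositePaths-sameEndSign paths (+ , q) = - , _ , paths - , reversePath q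
  OppositePaths-sameEndSign paths (- , q) = + , _ , paths + , reversePath q

lemma2p2 : (B : Bidirected) →
    (∀ v w → v ≢ w → PathTo B v + w × PathTo B v - w) →
    StronglyConnected B
lemma2p2 B paths v w v≢w with paths v w v≢w | paths w v (v≢w ∘ sym)
... | (+ , p₊) , (- , p₋) | _      = + , + , p₊ , p₋
... | (- , p₊) , (+ , p₋) | _      = + , - , p₊ , p₋
... | (+ , p₊) , (+ , p₋) | _ , q  = OppositePaths-sameEndSign B (λ { + → p₊ ; - → p₋ }) q
... | (- , p₊) , (- , p₋) | q , _  = OppositePaths-sameEndSign B (λ { + → p₊ ; - → p₋ }) q
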